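{- For $n\ge 0$ let $$A_n(x)=\frac{1}{n!}\sum_{k=1}^{n}\binom{n}{k}\left(H_n-H_{n-k}\right)x^{k-1}\in\mathbb{Q}[x],$$ where $H_m=\sum_{i=1}^m 1/i$ ($H_0=0$). Let $\alpha_n$ be the least common multiple of the denominators of the coefficients of $A_n(x)$, each coefficient written in lowest terms. Then for every $n\ge 1$, $$\alpha_n = n!\,\operatorname{lcm}(1,2,\dots,n).$$
   Context: The polynomial $A_n$ is characterized by $f_n(x)=-xA_n(x)+\frac{(1+x)^n}{n!}\ln(1+x)$, where $f_0(x)=\ln(1+x)$ and $f_n(x)=\int_0^x f_{n-1}(t)\,dt$. -}

module Defs where

open import Data.Nat using (ℕ; zero; suc; _∸_)
open import Data.Nat.LCM using (lcm)
open import Data.Nat.Combinatorics using (_C_)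
open import Data.Nat.Properties using (_!≢0)
import Data.Nat as ℕ
open import Data.Integer using (+_)
open import Data.Rational using (ℚ; 0ℚ; _+_; _-_; _*_; _/_; ↧ₙ_)
open import Data.List using (List; map; foldr; upTo)

H : ℕ → ℚ
H zero    = 0ℚ
H (suc m) = H m + (+ 1 / suc m)

fact : ℕ → ℕ
fact = ℕ._!

-- coefficient of x^(k-1) in A_n(x), for 1 ≤ k ≤ n:
--   (1/n!) * binom(n,k) * (H_n - H_{n-k})
coeffA : ℕ → ℕ → ℚ
coeffA n k = ((+ (n C k)) / fact n) {{n !≢0}} * (H n - H (n ∸ k))

coeffsA : ℕ → List ℚ
coeffsA n = map (λ j → coeffA n (suc j)) (upTo n)

lcmList : List ℕ → ℕ
lcmList = foldr lcm 1

α : ℕ → ℕ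
α n = lcmList (map ↧ₙ_ (coeffsA n))

lcmUpTo : ℕ → ℕ
lcmUpTo n = lcmList (map suc (upTo n))

-- Put D n k = n! · coeffA n k = C(n,k) (H n − H (n − k)). For a natural number X, the
-- products D n k · X (k ≤ n) are all integers exactly when 1, …, n all divide X. If they
-- do, every H m · X with m ≤ n is an integer. Conversely, D obeys Pascal's rule
-- D n k + D n (k+1) = D (n+1) (k+1) for k < n (because (n − k) C(n+1,k+1) = (n+1) C(n,k+1)), so
-- integrality passes from row n + 1 down to row n, while the diagonal D n n = H n grows by
-- D (n+1) (n+1) − D n n = 1/(n+1); hence n + 1 divides X, and induction does the rest.
-- Since the denominator of q divides N iff q · N is an integer, the denominator of
-- coeffA n k divides n! · X iff D n k · X is an integer; together with n! ∣ α n (the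
-- constant coefficient of A n is 1/n!) this gives α n = n! · lcm(1, …, n).

module Submission where

open import Defs
open import Data.Nat as ℕ using (ℕ; zero; suc; _∸_; _≤_; _<_; _!; NonZero; z<s)
import Data.Nat.Properties as ℕP
open import Data.Nat.Combinatorics using (_C_; nCn≡1; nC1≡n; nCk+nC[k+1]≡[n+1]C[k+1])
open import Data.Nat.Coprimality as Coprime using (1-coprimeTo; coprime-divisor; recompute)
open import Data.Nat.Divisibility using (_∣_; divides; divides-refl; ∣-antisym; ∣-trans; *-monoʳ-∣; 1∣_)
open import Data.Nat.LCM using (m∣lcm[m,n]; n∣lcm[m,n]; lcm-least)
import Data.Nat.Tactic.RingSolver as ℕ-Solver
open import Data.Integer as ℤ using (ℤ; +_)
import Data.Integer.Properties as ℤP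
open import Data.Rational using (ℚ; mkℚ; _/_; 0ℚ; 1ℚ; ↥_; ↧ₙ_; _+_; _*_; _-_; -_)
open import Data.Rational.Properties
  using ( _≟_; +-*-commutativeRing; *-1-commutativeMonoid
        ; toℚᵘ-injective; toℚᵘ-homo-+; toℚᵘ-homo-*; toℚᵘ-homo‿-; toℚᵘ-fromℚᵘ
        ; normalize-coprime; ↥p/↧p≡p
        ; +-identityʳ; +-inverseʳ; *-identityˡ; *-identityʳ; *-zeroˡ; *-zeroʳ
        ; *-assoc; *-comm; *-distribʳ-+ )
import Data.Rational.Unnormalised as ℚᵘ
import Data.Rational.Unnormalised.Properties as ℚᵘP
open import Algebra.Bundles using (CommutativeMonoid)
open import Algebra.Properties.CommutativeSemigroup (CommutativeMonoid.commutativeSemigroup *-1-commutativeMonoid)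
  using (interchange; xy∙z≈y∙xz)
open import Data.List using ([]; _∷_; map; upTo)
open import Data.List.Properties using (map-∘)
open import Data.List.Relation.Unary.All as All using (All)
open import Data.List.Relation.Unary.All.Properties using (map⁺; map⁻; applyUpTo⁺₁; applyUpTo⁻)
open import Data.Product using (∃-syntax; _,_)
open import Data.Sum using (inj₁; inj₂)
open import Function using (id; _∘_)
open import Level using (0ℓ)
open import Relation.Nullary.Decidable using (dec⇒maybe)
open import Tactic.RingSolver using (solve-∀)
open import Tactic.RingSolver.Core.AlmostCommutativeRing using (AlmostCommutativeRing; fromCommutativeRing)
open import Relation.Binary.PropositionalEquality
open ≡-Reasoning

[k+1]*[n+1]C[k+1]≡[n+1]*nCk : ∀ n k → suc k ℕ.* (suc n C suc k) ≡ suc n ℕ.* (n C k)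
[k+1]*[n+1]C[k+1]≡[n+1]*nCk zero    zero    = refl
[k+1]*[n+1]C[k+1]≡[n+1]*nCk zero    (suc k) = ℕP.*-zeroʳ (suc (suc k))
[k+1]*[n+1]C[k+1]≡[n+1]*nCk (suc n) zero    =
  trans (ℕP.*-identityˡ (suc (suc n) C 1)) (trans (nC1≡n (suc (suc n))) (sym (ℕP.*-identityʳ (suc (suc n)))))
[k+1]*[n+1]C[k+1]≡[n+1]*nCk (suc n) (suc k) = begin
  suc (suc k) ℕ.* (suc (suc n) C suc (suc k))
    ≡⟨ cong (suc (suc k) ℕ.*_) (nCk+nC[k+1]≡[n+1]C[k+1] (suc n) (suc k)) ⟨
  suc (suc k) ℕ.* (a ℕ.+ b)
    ≡⟨ split k a b ⟩
  (suc k ℕ.* a ℕ.+ suc (suc k) ℕ.* b) ℕ.+ a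
    ≡⟨ cong (ℕ._+ a) (cong₂ ℕ._+_ ([k+1]*[n+1]C[k+1]≡[n+1]*nCk n k) ([k+1]*[n+1]C[k+1]≡[n+1]*nCk n (suc k))) ⟩
  (suc n ℕ.* (n C k) ℕ.+ suc n ℕ.* (n C suc k)) ℕ.+ a
    ≡⟨ cong (ℕ._+ a) (ℕP.*-distribˡ-+ (suc n) (n C k) (n C suc k)) ⟨
  suc n ℕ.* (n C k ℕ.+ n C suc k) ℕ.+ a
    ≡⟨ cong (λ c → suc n ℕ.* c ℕ.+ a) (nCk+nC[k+1]≡[n+1]C[k+1] n k) ⟩
  suc n ℕ.* a ℕ.+ a
    ≡⟨ ℕP.+-comm (suc n ℕ.* a) a ⟩
  suc (suc n) ℕ.* a ∎
  where
  a = suc n C suc k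
  b = suc n C suc (suc k)
  split : ∀ k a b → suc (suc k) ℕ.* (a ℕ.+ b) ≡ (suc k ℕ.* a ℕ.+ suc (suc k) ℕ.* b) ℕ.+ a
  split = ℕ-Solver.solve-∀

[n∸k]*[n+1]C[k+1]≡[n+1]*nC[k+1] : ∀ n k → (n ∸ k) ℕ.* (suc n C suc k) ≡ suc n ℕ.* (n C suc k)
[n∸k]*[n+1]C[k+1]≡[n+1]*nC[k+1] n k = begin
  (suc n ∸ suc k) ℕ.* c
    ≡⟨ ℕP.*-distribʳ-∸ c (suc n) (suc k) ⟩
  suc n ℕ.* c ∸ suc k ℕ.* c
    ≡⟨ cong₂ _∸_ (cong (suc n ℕ.*_) (sym (nCk+nC[k+1]≡[n+1]C[k+1] n k))) ([k+1]*[n+1]C[k+1]≡[n+1]*nCk n k) ⟩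
  suc n ℕ.* (n C k ℕ.+ n C suc k) ∸ suc n ℕ.* (n C k)
    ≡⟨ cong (_∸ suc n ℕ.* (n C k)) (ℕP.*-distribˡ-+ (suc n) (n C k) (n C suc k)) ⟩
  suc n ℕ.* (n C k) ℕ.+ suc n ℕ.* (n C suc k) ∸ suc n ℕ.* (n C k)
    ≡⟨ ℕP.m+n∸m≡n (suc n ℕ.* (n C k)) (suc n ℕ.* (n C suc k)) ⟩
  suc n ℕ.* (n C suc k) ∎
  where
  c = suc n C suc k

lcmList-least : ∀ {N} xs → All (_∣ N) xs → lcmList xs ∣ N
lcmList-least []       All.[]         = 1∣ _
lcmList-least (x ∷ xs) (x∣N All.∷ xs∣N) = lcm-least x∣N (lcmList-least xs xs∣N)

∣lcmList : ∀ xs → All (_∣ lcmList xs) xs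
∣lcmList []       = All.[]
∣lcmList (x ∷ xs) =
  m∣lcm[m,n] x (lcmList xs) All.∷ All.map (λ y∣ → ∣-trans y∣ (n∣lcm[m,n] x (lcmList xs))) (∣lcmList xs)

f∣lcmList[map-f-upTo] : ∀ f {n i} → i < n → f i ∣ lcmList (map f (upTo n))
f∣lcmList[map-f-upTo] f {n} = applyUpTo⁻ id n (map⁻ (∣lcmList (map f (upTo n))))

lcmList[map-f-upTo]-least : ∀ f {n N} → (∀ {i} → i < n → f i ∣ N) → lcmList (map f (upTo n)) ∣ N
lcmList[map-f-upTo]-least f {n} f∣N = lcmList-least (map f (upTo n)) (map⁺ (applyUpTo⁺₁ id n f∣N))

ℚ-ring : AlmostCommutativeRing 0ℓ 0ℓ
ℚ-ring = fromCommutativeRing +-*-commutativeRing (λ q → dec⇒maybe (0ℚ ≟ q))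

[p-q]*r≡p*r-q*r : ∀ p q r → (p - q) * r ≡ p * r - q * r
[p-q]*r≡p*r-q*r = solve-∀ ℚ-ring

p+q-p≡q : ∀ p q → p + q - p ≡ q
p+q-p≡q = solve-∀ ℚ-ring

fromℤ : ℤ → ℚ
fromℤ z = mkℚ z 0 (Coprime.sym (1-coprimeTo _))

fromℕ : ℕ → ℚ
fromℕ n = fromℤ (+ n)

fromℤ-homo-+ : ∀ a b → fromℤ (a ℤ.+ b) ≡ fromℤ a + fromℤ b
fromℤ-homo-+ a b = toℚᵘ-injective (ℚᵘP.≃-sym (ℚᵘP.≃-trans (toℚᵘ-homo-+ (fromℤ a) (fromℤ b))
  (ℚᵘ.*≡* (cong (ℤ._* + 1) (cong₂ ℤ._+_ (ℤP.*-identityʳ a) (ℤP.*-identityʳ b))))))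

fromℤ-homo-* : ∀ a b → fromℤ (a ℤ.* b) ≡ fromℤ a * fromℤ b
fromℤ-homo-* a b = toℚᵘ-injective (ℚᵘP.≃-sym (toℚᵘ-homo-* (fromℤ a) (fromℤ b)))

fromℤ-homo‿- : ∀ a → fromℤ (ℤ.- a) ≡ - fromℤ a
fromℤ-homo‿- a = toℚᵘ-injective (ℚᵘP.≃-sym (toℚᵘ-homo‿- (fromℤ a)))

fromℕ-homo-+ : ∀ m n → fromℕ (m ℕ.+ n) ≡ fromℕ m + fromℕ n
fromℕ-homo-+ m n = trans (cong fromℤ (ℤP.pos-+ m n)) (fromℤ-homo-+ (+ m) (+ n))

fromℕ-homo-* : ∀ m n → fromℕ (m ℕ.* n) ≡ fromℕ m * fromℕ n
fromℕ-homo-* m n = trans (cong fromℤ (ℤP.pos-* m n)) (fromℤ-homo-* (+ m) (+ n))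

i/n≡i*[1/n] : ∀ i n .{{_ : NonZero n}} → i / n ≡ fromℤ i * (+ 1 / n)
i/n≡i*[1/n] i (suc n) = toℚᵘ-injective (ℚᵘP.≃-trans (toℚᵘ-fromℚᵘ (ℚᵘ.mkℚᵘ i n))
  (ℚᵘP.≃-sym (ℚᵘP.≃-trans (toℚᵘ-homo-* (fromℤ i) (+ 1 / suc n))
    (ℚᵘP.≃-trans (ℚᵘP.*-congˡ {ℚᵘ.mkℚᵘ i 0} (toℚᵘ-fromℚᵘ (ℚᵘ.mkℚᵘ (+ 1) n)))
      (ℚᵘ.*≡* (cong₂ ℤ._*_ (ℤP.*-identityʳ i) (cong (λ m → + suc m) (sym (ℕP.+-identityʳ n)))))))))

1/n*n≡1 : ∀ n .{{_ : NonZero n}} → (+ 1 / n) * fromℕ n ≡ 1ℚ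
1/n*n≡1 (suc n) = toℚᵘ-injective (ℚᵘP.≃-trans (toℚᵘ-homo-* (+ 1 / suc n) (fromℕ (suc n)))
  (ℚᵘP.≃-trans (ℚᵘP.*-congʳ (toℚᵘ-fromℚᵘ (ℚᵘ.mkℚᵘ (+ 1) n)))
    (ℚᵘ.*≡* (trans (ℤP.*-identityʳ _) (cong (λ m → + 1 ℤ.* + suc m) (sym (ℕP.*-identityʳ n)))))))

↧ₙ[1/n]≡n : ∀ n .{{_ : NonZero n}} → ↧ₙ (+ 1 / n) ≡ n
↧ₙ[1/n]≡n (suc n) = cong ↧ₙ_ (normalize-coprime (1-coprimeTo (suc n)))

n*p*[1/n*q]≡p*q : ∀ n .{{_ : NonZero n}} p q → fromℕ n * p * ((+ 1 / n) * q) ≡ p * q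
n*p*[1/n*q]≡p*q n p q = begin
  fromℕ n * p * ((+ 1 / n) * q)   ≡⟨ interchange (fromℕ n) p (+ 1 / n) q ⟩
  fromℕ n * (+ 1 / n) * (p * q)   ≡⟨ cong (_* (p * q)) (trans (*-comm (fromℕ n) (+ 1 / n)) (1/n*n≡1 n)) ⟩
  1ℚ * (p * q)                    ≡⟨ *-identityˡ (p * q) ⟩
  p * q                           ∎

m*p≡n*q⇒p/n≡q/m : ∀ m n .{{_ : NonZero m}} .{{_ : NonZero n}} p q →
                  fromℕ m * p ≡ fromℕ n * q → p * (+ 1 / n) ≡ q * (+ 1 / m)
m*p≡n*q⇒p/n≡q/m m n p q eq = begin
  p * (+ 1 / n)                               ≡⟨ n*p*[1/n*q]≡p*q m p (+ 1 / n) ⟨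
  fromℕ m * p * ((+ 1 / m) * (+ 1 / n))       ≡⟨ cong₂ _*_ eq (*-comm (+ 1 / m) (+ 1 / n)) ⟩
  fromℕ n * q * ((+ 1 / n) * (+ 1 / m))       ≡⟨ n*p*[1/n*q]≡p*q n q (+ 1 / m) ⟩
  q * (+ 1 / m)                               ∎

q*↧q≡↥q : ∀ q → q * fromℕ (↧ₙ q) ≡ fromℤ (↥ q)
q*↧q≡↥q q@(mkℚ n d _) = begin
  q * fromℕ (suc d)                          ≡⟨ cong (_* fromℕ (suc d)) (↥p/↧p≡p q) ⟨
  (n / suc d) * fromℕ (suc d)                ≡⟨ cong (_* fromℕ (suc d)) (i/n≡i*[1/n] n (suc d)) ⟩
  fromℤ n * (+ 1 / suc d) * fromℕ (suc d)    ≡⟨ *-assoc (fromℤ n) (+ 1 / suc d) (fromℕ (suc d)) ⟩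
  fromℤ n * ((+ 1 / suc d) * fromℕ (suc d))  ≡⟨ cong (fromℤ n *_) (1/n*n≡1 (suc d)) ⟩
  fromℤ n * 1ℚ                               ≡⟨ *-identityʳ (fromℤ n) ⟩
  fromℤ n                                    ∎

IsInteger : ℚ → Set
IsInteger q = ∃[ z ] q ≡ fromℤ z

fromℤ-isInteger : ∀ z → IsInteger (fromℤ z)
fromℤ-isInteger z = z , refl

isInteger-sum : ∀ {p q} → IsInteger p → IsInteger q → IsInteger (p + q)
isInteger-sum (a , refl) (b , refl) = a ℤ.+ b , sym (fromℤ-homo-+ a b)

isInteger-product : ∀ {p q} → IsInteger p → IsInteger q → IsInteger (p * q)
isInteger-product (a , refl) (b , refl) = a ℤ.* b , sym (fromℤ-homo-* a b)

isInteger-difference : ∀ {p q} → IsInteger p → IsInteger q → IsInteger (p - q)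
isInteger-difference (a , refl) (b , refl) =
  a ℤ.- b , sym (trans (fromℤ-homo-+ a (ℤ.- b)) (cong (λ r → fromℤ a + r) (fromℤ-homo‿- b)))

↧ₙ∣⇒isInteger : ∀ q {N} → ↧ₙ q ∣ N → IsInteger (q * fromℕ N)
↧ₙ∣⇒isInteger q (divides-refl c) = ↥ q ℤ.* + c , (begin
  q * fromℕ (c ℕ.* ↧ₙ q)              ≡⟨ cong (q *_) (fromℕ-homo-* c (↧ₙ q)) ⟩
  q * (fromℕ c * fromℕ (↧ₙ q))        ≡⟨ cong (q *_) (*-comm (fromℕ c) (fromℕ (↧ₙ q))) ⟩
  q * (fromℕ (↧ₙ q) * fromℕ c)        ≡⟨ *-assoc q (fromℕ (↧ₙ q)) (fromℕ c) ⟨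
  q * fromℕ (↧ₙ q) * fromℕ c          ≡⟨ cong (_* fromℕ c) (q*↧q≡↥q q) ⟩
  fromℤ (↥ q) * fromℕ c               ≡⟨ fromℤ-homo-* (↥ q) (+ c) ⟨
  fromℤ (↥ q ℤ.* + c)                 ∎)

isInteger⇒↧ₙ∣ : ∀ q {N} → IsInteger (q * fromℕ N) → ↧ₙ q ∣ N
isInteger⇒↧ₙ∣ q@(mkℚ n d coprime) {N} (z , q*N≡z) =
  coprime-divisor (Coprime.sym (recompute coprime)) (divides ℤ.∣ z ∣ ∣n∣*N≡∣z∣*[1+d])
  where
  n*N≡z*[1+d] : fromℤ (n ℤ.* + N) ≡ fromℤ (z ℤ.* + suc d)
  n*N≡z*[1+d] = begin
    fromℤ (n ℤ.* + N)                    ≡⟨ fromℤ-homo-* n (+ N) ⟩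
    fromℤ n * fromℕ N                    ≡⟨ cong (_* fromℕ N) (q*↧q≡↥q q) ⟨
    q * fromℕ (suc d) * fromℕ N          ≡⟨ *-assoc q (fromℕ (suc d)) (fromℕ N) ⟩
    q * (fromℕ (suc d) * fromℕ N)        ≡⟨ cong (q *_) (*-comm (fromℕ (suc d)) (fromℕ N)) ⟩
    q * (fromℕ N * fromℕ (suc d))        ≡⟨ *-assoc q (fromℕ N) (fromℕ (suc d)) ⟨
    q * fromℕ N * fromℕ (suc d)          ≡⟨ cong (_* fromℕ (suc d)) q*N≡z ⟩
    fromℤ z * fromℕ (suc d)              ≡⟨ fromℤ-homo-* z (+ suc d) ⟨
    fromℤ (z ℤ.* + suc d)                ∎
  ∣n∣*N≡∣z∣*[1+d] : ℤ.∣ n ∣ ℕ.* N ≡ ℤ.∣ z ∣ ℕ.* suc d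
  ∣n∣*N≡∣z∣*[1+d] = begin
    ℤ.∣ n ∣ ℕ.* N              ≡⟨ ℤP.abs-* n (+ N) ⟨
    ℤ.∣ n ℤ.* + N ∣            ≡⟨ cong (ℤ.∣_∣ ∘ ↥_) n*N≡z*[1+d] ⟩
    ℤ.∣ z ℤ.* + suc d ∣        ≡⟨ ℤP.abs-* z (+ suc d) ⟩
    ℤ.∣ z ∣ ℕ.* suc d          ∎

H*X-isInteger : ∀ {X} m → (∀ {i} → i < m → suc i ∣ X) → IsInteger (H m * fromℕ X)
H*X-isInteger {X} zero _ = + 0 , *-zeroˡ (fromℕ X)
H*X-isInteger {X} (suc m) ∣X = subst IsInteger (sym (*-distribʳ-+ (fromℕ X) (H m) (+ 1 / suc m)))
  (isInteger-sum (H*X-isInteger m (∣X ∘ ℕP.m<n⇒m<1+n))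
               (↧ₙ∣⇒isInteger (+ 1 / suc m) (subst (_∣ X) (sym (↧ₙ[1/n]≡n (suc m))) (∣X ℕP.≤-refl))))

D : ℕ → ℕ → ℚ
D n k = fromℕ (n C k) * (H n - H (n ∸ k))

D-zero : ∀ n → D n 0 ≡ 0ℚ
D-zero n = trans (cong (fromℕ (n C 0) *_) (+-inverseʳ (H n))) (*-zeroʳ (fromℕ (n C 0)))

D-diag : ∀ n → D n n ≡ H n
D-diag n = begin
  D n n             ≡⟨ cong₂ (λ c j → fromℕ c * (H n - H j)) (nCn≡1 n) (ℕP.n∸n≡0 n) ⟩
  1ℚ * (H n - 0ℚ)   ≡⟨ *-identityˡ (H n - 0ℚ) ⟩
  H n - 0ℚ          ≡⟨ +-identityʳ (H n) ⟩
  H n               ∎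

D-one : ∀ n → D (suc n) 1 ≡ 1ℚ
D-one n = begin
  fromℕ (suc n C 1) * (H n + (+ 1 / suc n) - H n)
    ≡⟨ cong₂ _*_ (cong fromℕ (nC1≡n (suc n))) (p+q-p≡q (H n) (+ 1 / suc n)) ⟩
  fromℕ (suc n) * (+ 1 / suc n)
    ≡⟨ *-comm (fromℕ (suc n)) (+ 1 / suc n) ⟩
  (+ 1 / suc n) * fromℕ (suc n)
    ≡⟨ 1/n*n≡1 (suc n) ⟩
  1ℚ ∎

D-pascal : ∀ {n k} → k < n → D n k + D n (suc k) ≡ D (suc n) (suc k)
D-pascal {n} {k} k<n = begin
  D n k + D n (suc k)
    ≡⟨ cong (λ j → b * (H n - H j) + a * (H n - H m)) n∸k≡1+m ⟩
  b * (H n - (H m + hM)) + a * (H n - H m)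
    ≡⟨ regroup a b (H n) (H m) hN hM ⟩
  (b + a) * ΔH + (a * hM - (b + a) * hN)
    ≡⟨ cong (λ t → (b + a) * ΔH + (t - (b + a) * hN)) a*hM≡[b+a]*hN ⟩
  (b + a) * ΔH + ((b + a) * hN - (b + a) * hN)
    ≡⟨ cong (λ t → (b + a) * ΔH + t) (+-inverseʳ ((b + a) * hN)) ⟩
  (b + a) * ΔH + 0ℚ
    ≡⟨ +-identityʳ ((b + a) * ΔH) ⟩
  (b + a) * ΔH
    ≡⟨ cong₂ (λ c j → c * (H (suc n) - H j)) b+a≡c (sym n∸k≡1+m) ⟩
  D (suc n) (suc k) ∎
  where
  m = n ∸ suc k
  n∸k≡1+m : n ∸ k ≡ suc m
  n∸k≡1+m = ℕP.+-∸-assoc 1 k<n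
  a = fromℕ (n C suc k)
  b = fromℕ (n C k)
  hN = + 1 / suc n
  hM = + 1 / suc m
  ΔH = (H n + hN) - (H m + hM)
  b+a≡c : b + a ≡ fromℕ (suc n C suc k)
  b+a≡c = trans (sym (fromℕ-homo-+ (n C k) (n C suc k))) (cong fromℕ (nCk+nC[k+1]≡[n+1]C[k+1] n k))
  a*hM≡[b+a]*hN : a * hM ≡ (b + a) * hN
  a*hM≡[b+a]*hN = m*p≡n*q⇒p/n≡q/m (suc n) (suc m) a (b + a) (begin
    fromℕ (suc n) * a                      ≡⟨ fromℕ-homo-* (suc n) (n C suc k) ⟨
    fromℕ (suc n ℕ.* (n C suc k))          ≡⟨ cong fromℕ ([n∸k]*[n+1]C[k+1]≡[n+1]*nC[k+1] n k) ⟨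
    fromℕ ((n ∸ k) ℕ.* (suc n C suc k))    ≡⟨ cong (λ j → fromℕ (j ℕ.* (suc n C suc k))) n∸k≡1+m ⟩
    fromℕ (suc m ℕ.* (suc n C suc k))      ≡⟨ fromℕ-homo-* (suc m) (suc n C suc k) ⟩
    fromℕ (suc m) * fromℕ (suc n C suc k)  ≡⟨ cong (fromℕ (suc m) *_) b+a≡c ⟨
    fromℕ (suc m) * (b + a)                ∎)
  regroup : ∀ a b x y hN hM →
            b * (x - (y + hM)) + a * (x - y) ≡ (b + a) * ((x + hN) - (y + hM)) + (a * hM - (b + a) * hN)
  regroup = solve-∀ ℚ-ring

coeffA≡[1/n!]*D : ∀ n k → coeffA n k ≡ (+ 1 / n !) {{n ℕP.!≢0}} * D n k
coeffA≡[1/n!]*D n k = begin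
  (+ (n C k) / n !) {{n ℕP.!≢0}} * ΔH  ≡⟨ cong (_* ΔH) (i/n≡i*[1/n] (+ (n C k)) (n !) {{n ℕP.!≢0}}) ⟩
  fromℕ (n C k) * u * ΔH               ≡⟨ xy∙z≈y∙xz (fromℕ (n C k)) u ΔH ⟩
  u * D n k                            ∎
  where
  u = (+ 1 / n !) {{n ℕP.!≢0}}
  ΔH = H n - H (n ∸ k)

coeffA*[n!*X]≡D*X : ∀ n k X → coeffA n k * fromℕ (n ! ℕ.* X) ≡ D n k * fromℕ X
coeffA*[n!*X]≡D*X n k X = begin
  coeffA n k * fromℕ (n ! ℕ.* X)            ≡⟨ cong₂ _*_ (coeffA≡[1/n!]*D n k) (fromℕ-homo-* (n !) X) ⟩
  u * D n k * (fromℕ (n !) * fromℕ X)       ≡⟨ *-comm (u * D n k) (fromℕ (n !) * fromℕ X) ⟩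
  fromℕ (n !) * fromℕ X * (u * D n k)       ≡⟨ n*p*[1/n*q]≡p*q (n !) {{n ℕP.!≢0}} (fromℕ X) (D n k) ⟩
  fromℕ X * D n k                           ≡⟨ *-comm (fromℕ X) (D n k) ⟩
  D n k * fromℕ X                           ∎
  where
  u = (+ 1 / n !) {{n ℕP.!≢0}}

↧ₙcoeffA[1+n,1]≡[1+n]! : ∀ n → ↧ₙ (coeffA (suc n) 1) ≡ suc n !
↧ₙcoeffA[1+n,1]≡[1+n]! n = begin
  ↧ₙ (coeffA (suc n) 1)      ≡⟨ cong ↧ₙ_ (coeffA≡[1/n!]*D (suc n) 1) ⟩
  ↧ₙ (u * D (suc n) 1)       ≡⟨ cong (λ d → ↧ₙ (u * d)) (D-one n) ⟩
  ↧ₙ (u * 1ℚ)                ≡⟨ cong ↧ₙ_ (*-identityʳ u) ⟩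
  ↧ₙ u                       ≡⟨ ↧ₙ[1/n]≡n (suc n !) {{suc n ℕP.!≢0}} ⟩
  suc n !                    ∎
  where
  u = (+ 1 / suc n !) {{suc n ℕP.!≢0}}

↧ₙcoeffA∣n!*X⇒D*X-isInteger : ∀ n k {X} → ↧ₙ (coeffA n k) ∣ n ! ℕ.* X → IsInteger (D n k * fromℕ X)
↧ₙcoeffA∣n!*X⇒D*X-isInteger n k {X} ∣n!X =
  subst IsInteger (coeffA*[n!*X]≡D*X n k X) (↧ₙ∣⇒isInteger (coeffA n k) ∣n!X)

D*X-isInteger⇒↧ₙcoeffA∣n!*X : ∀ n k {X} → IsInteger (D n k * fromℕ X) → ↧ₙ (coeffA n k) ∣ n ! ℕ.* X
D*X-isInteger⇒↧ₙcoeffA∣n!*X n k {X} D*X∈ℤ =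
  isInteger⇒↧ₙ∣ (coeffA n k) (subst IsInteger (sym (coeffA*[n!*X]≡D*X n k X)) D*X∈ℤ)

ClearsRow : ℕ → ℕ → Set
ClearsRow X n = ∀ {k} → k ≤ n → IsInteger (D n k * fromℕ X)

D[n,0]*X-isInteger : ∀ n X → IsInteger (D n 0 * fromℕ X)
D[n,0]*X-isInteger n X = + 0 , trans (cong (_* fromℕ X) (D-zero n)) (*-zeroˡ (fromℕ X))

divisible⇒clearsRow : ∀ {X} n → (∀ {i} → i < n → suc i ∣ X) → ClearsRow X n
divisible⇒clearsRow {X} n ∣X {k} _ = subst IsInteger C*[H*X-H'*X]≡D*X
  (isInteger-product (fromℤ-isInteger (+ (n C k)))
    (isInteger-difference (H*X-isInteger n ∣X)
      (H*X-isInteger (n ∸ k) (λ i<n∸k → ∣X (ℕP.<-≤-trans i<n∸k (ℕP.m∸n≤m n k))))))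
  where
  C*[H*X-H'*X]≡D*X : fromℕ (n C k) * (H n * fromℕ X - H (n ∸ k) * fromℕ X) ≡ D n k * fromℕ X
  C*[H*X-H'*X]≡D*X = trans (cong (fromℕ (n C k) *_) (sym ([p-q]*r≡p*r-q*r (H n) (H (n ∸ k)) (fromℕ X))))
                           (sym (*-assoc (fromℕ (n C k)) (H n - H (n ∸ k)) (fromℕ X)))

clearsRow-pred : ∀ {X} n → ClearsRow X (suc n) → ClearsRow X n
clearsRow-pred {X} n clears {zero}  _   = D[n,0]*X-isInteger n X
clearsRow-pred {X} n clears {suc k} k<n = subst IsInteger D'*X-D*X≡D''*X
  (isInteger-difference (clears (ℕP.m≤n⇒m≤1+n k<n)) (clearsRow-pred n clears (ℕP.<⇒≤ k<n)))
  where
  D'*X-D*X≡D''*X : D (suc n) (suc k) * fromℕ X - D n k * fromℕ X ≡ D n (suc k) * fromℕ X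
  D'*X-D*X≡D''*X = begin
    D (suc n) (suc k) * fromℕ X - D n k * fromℕ X     ≡⟨ [p-q]*r≡p*r-q*r (D (suc n) (suc k)) (D n k) (fromℕ X) ⟨
    (D (suc n) (suc k) - D n k) * fromℕ X             ≡⟨ cong (λ d → (d - D n k) * fromℕ X) (D-pascal k<n) ⟨
    (D n k + D n (suc k) - D n k) * fromℕ X           ≡⟨ cong (_* fromℕ X) (p+q-p≡q (D n k) (D n (suc k))) ⟩
    D n (suc k) * fromℕ X                             ∎

clearsRow⇒suc∣ : ∀ {X} n → ClearsRow X (suc n) → suc n ∣ X
clearsRow⇒suc∣ {X} n clears = subst (_∣ X) (↧ₙ[1/n]≡n (suc n)) (isInteger⇒↧ₙ∣ (+ 1 / suc n)
  (subst IsInteger D'*X-D*X≡X/[1+n] (isInteger-difference (clears ℕP.≤-refl) (clearsRow-pred n clears ℕP.≤-refl))))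
  where
  D'*X-D*X≡X/[1+n] : D (suc n) (suc n) * fromℕ X - D n n * fromℕ X ≡ (+ 1 / suc n) * fromℕ X
  D'*X-D*X≡X/[1+n] = begin
    D (suc n) (suc n) * fromℕ X - D n n * fromℕ X     ≡⟨ [p-q]*r≡p*r-q*r (D (suc n) (suc n)) (D n n) (fromℕ X) ⟨
    (D (suc n) (suc n) - D n n) * fromℕ X             ≡⟨ cong₂ (λ p q → (p - q) * fromℕ X) (D-diag (suc n)) (D-diag n) ⟩
    (H n + (+ 1 / suc n) - H n) * fromℕ X             ≡⟨ cong (_* fromℕ X) (p+q-p≡q (H n) (+ 1 / suc n)) ⟩
    (+ 1 / suc n) * fromℕ X                           ∎

clearsRow⇒divisible : ∀ {X} n → ClearsRow X n → ∀ {i} → i < n → suc i ∣ X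
clearsRow⇒divisible (suc n) clears i<1+n with ℕP.m<1+n⇒m<n∨m≡n i<1+n
... | inj₁ i<n  = clearsRow⇒divisible n (clearsRow-pred n clears) i<n
... | inj₂ refl = clearsRow⇒suc∣ n clears

theorem3p1 : (n : ℕ) → α (suc n) ≡ fact (suc n) ℕ.* lcmUpTo (suc n)
theorem3p1 n = ∣-antisym α∣N!*L N!*L∣α
  where
  N = suc n
  den : ℕ → ℕ
  den j = ↧ₙ (coeffA N (suc j))
  α≡lcm-den : α N ≡ lcmList (map den (upTo N))
  α≡lcm-den = cong lcmList (sym (map-∘ (upTo N)))
  den∣α : ∀ {j} → j < N → den j ∣ α N
  den∣α {j} j<N = subst (den j ∣_) (sym α≡lcm-den) (f∣lcmList[map-f-upTo] den j<N)
  α∣N!*L : α N ∣ N ! ℕ.* lcmUpTo N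
  α∣N!*L = subst (_∣ N ! ℕ.* lcmUpTo N) (sym α≡lcm-den) (lcmList[map-f-upTo]-least den (λ {j} j<N →
    D*X-isInteger⇒↧ₙcoeffA∣n!*X N (suc j) (divisible⇒clearsRow N (f∣lcmList[map-f-upTo] suc) j<N)))
  N!∣α : N ! ∣ α N
  N!∣α = subst (_∣ α N) (↧ₙcoeffA[1+n,1]≡[1+n]! n) (den∣α z<s)
  X = _∣_.quotient N!∣α
  α≡N!*X : α N ≡ N ! ℕ.* X
  α≡N!*X = trans (_∣_.equality N!∣α) (ℕP.*-comm X (N !))
  clears : ClearsRow X N
  clears {zero}  _   = D[n,0]*X-isInteger N X
  clears {suc j} j<N = ↧ₙcoeffA∣n!*X⇒D*X-isInteger N (suc j) (subst (den j ∣_) α≡N!*X (den∣α j<N))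
  N!*L∣α : N ! ℕ.* lcmUpTo N ∣ α N
  N!*L∣α = subst (N ! ℕ.* lcmUpTo N ∣_) (sym α≡N!*X)
    (*-monoʳ-∣ (N !) (lcmList[map-f-upTo]-least suc (clearsRow⇒divisible N clears)))
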